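{- Let $N\ge 2$ and let $A_1,A_2,\ldots$ be a quasifibonacci sequence of level $N$. Let $k\ge 1$ and let $n$ be an integer with $A_k\le n<A_{k+1}$. Then every $a\in S_n$ satisfies $l(a)\in\{k-1,k\}$.
   Context: For an integer $N\ge 2$, a sequence $A_1,A_2,\ldots$ of positive integers is a quasifibonacci sequence of level $N$ if $A_{k+N}=A_{k+N-1}+\cdots+A_k$ for all $k\ge 1$, and $A_k>A_{k-1}+\cdots+A_1$ for all $1\le k\le N$. Let $\{0,1\}^{\omega}$ be the set of sequences $(a_1,a_2,\ldots)$ with $a_i\in\{0,1\}$ and $a_i=0$ for all but finitely many $i$. For an integer $n\ge 0$, $S_n=\{a\in\{0,1\}^{\omega}:\sum_{i\ge1}a_iA_i=n\}$ (partitions of $n$ into distinct terms of the sequence). For a nonzero $a\in\{0,1\}^\omega$, the length $l(a)$ is the largest $i$ with $a_i=1$. -}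

module Defs where

open import Data.Nat using (ℕ; zero; suc; _+_; _*_; _≤_; _<_; _∸_)
open import Data.Bool using (Bool; true; false)
open import Data.Product using (Σ; _×_; ∃)
open import Relation.Binary.PropositionalEquality using (_≡_)

-- Sequences are functions ℕ → ℕ (resp. ℕ → Bool); only indices i ≥ 1 matter.

sumFrom1 : ℕ → (ℕ → ℕ) → ℕ
sumFrom1 zero    f = 0
sumFrom1 (suc m) f = sumFrom1 m f + f (suc m)

window : ℕ → ℕ → (ℕ → ℕ) → ℕ
window k zero    f = 0
window k (suc m) f = f (k + m) + window k m f

record Quasifibonacci (N : ℕ) (A : ℕ → ℕ) : Set where
  field
    positive  : ∀ i → 1 ≤ i → 1 ≤ A i
    recursion : ∀ k → 1 ≤ k → A (k + N) ≡ window k N A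
    initial   : ∀ k → 1 ≤ k → k ≤ N → sumFrom1 (k ∸ 1) A < A k

bit : Bool → ℕ
bit true  = 1
bit false = 0

-- an element of {0,1}^ω: a : ℕ → Bool (indices ≥ 1) with a_i = 0 for i > bound
record FinSeq : Set where
  field
    a       : ℕ → Bool
    bound   : ℕ
    support : ∀ i → bound < i → a i ≡ false

value : (ℕ → ℕ) → FinSeq → ℕ
value A s = sumFrom1 (FinSeq.bound s) (λ i → bit (FinSeq.a s i) * A i)

InS : (ℕ → ℕ) → ℕ → FinSeq → Set
InS A n s = value A s ≡ n

HasLength : FinSeq → ℕ → Set
HasLength s l = (1 ≤ l) × (FinSeq.a s l ≡ true) × (∀ i → l < i → FinSeq.a s i ≡ false)

-- Write N = 2 + N'. The recursion gives A (m+2) ≥ A (m+1) + A m once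
-- m > N' (the two top terms of the defining window), and the initial
-- condition handles smaller indices. From this we derive
--   (i)  A is non-decreasing on indices ≥ 1, and
--   (ii) A 1 + … + A (k-2) < A k for every k ≥ 1.
-- Given a ∈ S_n, a term A i used by a is at most n < A (k+1), so by (i)
-- no index i > k is used. If neither k nor k-1 is used either, then
-- n ≤ A 1 + … + A (k-2) < A k ≤ n by (ii), a contradiction.
module Submission where

open import Defs
open import Data.Nat using (ℕ; zero; suc; _+_; _*_; _≤_; _<_; _∸_; z≤n; s≤s)
open import Data.Nat.Properties
open import Data.Bool using (Bool; true; false)
open import Data.Sum using (_⊎_; inj₁; inj₂)
open import Data.Product using (_,_)
open import Data.Empty using (⊥-elim)
open import Relation.Nullary using (yes; no)
open import Relation.Binary.PropositionalEquality

sumFrom1-mono : ∀ (g h : ℕ → ℕ) b → (∀ i → g i ≤ h i) → sumFrom1 b g ≤ sumFrom1 b h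
sumFrom1-mono g h zero    g≤h = z≤n
sumFrom1-mono g h (suc b) g≤h = +-mono-≤ (sumFrom1-mono g h b g≤h) (g≤h (suc b))

sumFrom1-monoˡ : ∀ (g : ℕ → ℕ) {b c} → b ≤ c → sumFrom1 b g ≤ sumFrom1 c g
sumFrom1-monoˡ g {b} {c} b≤c with m≤n⇒m<n∨m≡n b≤c
... | inj₂ refl = ≤-refl
sumFrom1-monoˡ g {b} {suc c} _ | inj₁ (s≤s b≤c) =
  ≤-trans (sumFrom1-monoˡ g b≤c) (m≤m+n (sumFrom1 c g) (g (suc c)))

term≤sumFrom1 : ∀ (g : ℕ → ℕ) {i b} → 1 ≤ i → i ≤ b → g i ≤ sumFrom1 b g
term≤sumFrom1 g {suc i} _ i≤b =
  ≤-trans (m≤n+m (g (suc i)) (sumFrom1 i g)) (sumFrom1-monoˡ g i≤b)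

sumFrom1-vanishing : ∀ (g : ℕ → ℕ) m b → (∀ i → m < i → g i ≡ 0) →
  sumFrom1 b g ≤ sumFrom1 m g
sumFrom1-vanishing g m zero    _ = z≤n
sumFrom1-vanishing g m (suc b) g≡0 with suc b ≤? m
... | yes b<m = sumFrom1-monoˡ g b<m
... | no  b≮m = begin
  sumFrom1 b g + g (suc b) ≡⟨ cong (sumFrom1 b g +_) (g≡0 (suc b) (≰⇒> b≮m)) ⟩
  sumFrom1 b g + 0         ≡⟨ +-identityʳ (sumFrom1 b g) ⟩
  sumFrom1 b g             ≤⟨ sumFrom1-vanishing g m b g≡0 ⟩
  sumFrom1 m g             ∎
  where open ≤-Reasoning

VanishesAbove : (ℕ → Bool) → ℕ → Set
VanishesAbove a m = ∀ i → m < i → a i ≡ false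

bit*≤ : ∀ x y → bit x * y ≤ y
bit*≤ true  y = ≤-reflexive (+-identityʳ y)
bit*≤ false y = z≤n

used≤value : ∀ (A : ℕ → ℕ) (s : FinSeq) {i} → 1 ≤ i → FinSeq.a s i ≡ true →
  A i ≤ value A s
used≤value A s {i} 1≤i used with i ≤? FinSeq.bound s
... | no  i≰bound with () ← trans (sym used) (FinSeq.support s i (≰⇒> i≰bound))
... | yes i≤bound = begin
  A i                         ≡⟨ sym (+-identityʳ (A i)) ⟩
  bit true * A i              ≡⟨ cong (λ x → bit x * A i) (sym used) ⟩
  bit (FinSeq.a s i) * A i    ≤⟨ term≤sumFrom1 (λ j → bit (FinSeq.a s j) * A j) 1≤i i≤bound ⟩
  value A s                   ∎
  where open ≤-Reasoning

value≤sumFrom1 : ∀ (A : ℕ → ℕ) (s : FinSeq) m → VanishesAbove (FinSeq.a s) m →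
  value A s ≤ sumFrom1 m A
value≤sumFrom1 A s m vanish = ≤-trans
  (sumFrom1-vanishing g m (FinSeq.bound s) (λ i m<i → cong (λ x → bit x * A i) (vanish i m<i)))
  (sumFrom1-mono g A m (λ i → bit*≤ (FinSeq.a s i) (A i)))
  where
  g : ℕ → ℕ
  g i = bit (FinSeq.a s i) * A i

vanishesBelow : ∀ (a : ℕ → Bool) m → VanishesAbove a (suc m) → a (suc m) ≡ false →
  VanishesAbove a m
vanishesBelow a m vanish top i m<i with m≤n⇒m<n∨m≡n m<i
... | inj₁ m+1<i = vanish i m+1<i
... | inj₂ refl  = top

lengthOrLower : ∀ (s : FinSeq) m → VanishesAbove (FinSeq.a s) (suc m) →
  HasLength s (suc m) ⊎ VanishesAbove (FinSeq.a s) m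
lengthOrLower s m vanish with FinSeq.a s (suc m) in top
... | true  = inj₁ (s≤s z≤n , refl , vanish)
... | false = inj₂ (vanishesBelow (FinSeq.a s) m vanish top)

lengthNearTop : ∀ (s : FinSeq) j → VanishesAbove (FinSeq.a s) (suc j) →
  HasLength s j ⊎ HasLength s (suc j) ⊎ VanishesAbove (FinSeq.a s) (j ∸ 1)
lengthNearTop s j vanish with lengthOrLower s j vanish
... | inj₁ len = inj₂ (inj₁ len)
lengthNearTop s zero    _ | inj₂ vanish′ = inj₂ (inj₂ vanish′)
lengthNearTop s (suc i) _ | inj₂ vanish′ with lengthOrLower s i vanish′
... | inj₁ len     = inj₁ len
... | inj₂ vanish″ = inj₂ (inj₂ vanish″)

topTwo≤window : ∀ k N (f : ℕ → ℕ) → f (k + N) + f (k + suc N) ≤ window k (2 + N) f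
topTwo≤window k N f = begin
  f (k + N) + f (k + suc N)                     ≡⟨ +-comm (f (k + N)) (f (k + suc N)) ⟩
  f (k + suc N) + f (k + N)                     ≤⟨ +-monoʳ-≤ (f (k + suc N)) (m≤m+n (f (k + N)) (window k N f)) ⟩
  f (k + suc N) + (f (k + N) + window k N f)    ∎
  where open ≤-Reasoning

module QuasifibonacciFacts {N' : ℕ} {A : ℕ → ℕ} (Q : Quasifibonacci (2 + N') A) where
  open Quasifibonacci Q

  twoStep : ∀ m → N' < m → A m + A (suc m) ≤ A (suc (suc m))
  twoStep m N'<m = begin
    A m + A (suc m)               ≡⟨ cong₂ (λ x y → A x + A y) (sym j+N'≡m) (sym j+1+N'≡1+m) ⟩
    A (j + N') + A (j + suc N')   ≤⟨ topTwo≤window j N' A ⟩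
    window j (2 + N') A           ≡⟨ sym (recursion j (m<n⇒0<n∸m N'<m)) ⟩
    A (j + (2 + N'))              ≡⟨ cong A (trans (+-suc j (suc N')) (cong suc j+1+N'≡1+m)) ⟩
    A (suc (suc m))               ∎
    where
    open ≤-Reasoning
    -- m is the top-but-one index of the window starting at j
    j : ℕ
    j = m ∸ N'
    j+N'≡m : j + N' ≡ m
    j+N'≡m = m∸n+n≡m (<⇒≤ N'<m)
    j+1+N'≡1+m : j + suc N' ≡ suc m
    j+1+N'≡1+m = trans (+-suc j N') (cong suc j+N'≡m)

  step≤ : ∀ i → 1 ≤ i → A i ≤ A (suc i)
  step≤ i 1≤i with suc i ≤? 2 + N'
  ... | yes initialRange =
    ≤-trans (term≤sumFrom1 A 1≤i ≤-refl) (<⇒≤ (initial (suc i) (s≤s z≤n) initialRange))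
  step≤ (suc m) _ | no beyond =
    ≤-trans (m≤n+m (A (suc m)) (A m)) (twoStep m (≤-pred (≤-pred (≰⇒> beyond))))

  monotone : ∀ {i j} → 1 ≤ i → i ≤ j → A i ≤ A j
  monotone {i} {j} 1≤i i≤j with m≤n⇒m<n∨m≡n i≤j
  ... | inj₂ refl = ≤-refl
  monotone {i} {suc j} 1≤i _ | inj₁ (s≤s i≤j) =
    ≤-trans (monotone 1≤i i≤j) (step≤ j (≤-trans 1≤i i≤j))

  prefixSum<+2 : ∀ m → sumFrom1 m A < A (2 + m)
  prefixSum<+2 zero = positive 2 (s≤s z≤n)
  prefixSum<+2 (suc m) with 3 + m ≤? 2 + N'
  ... | yes initialRange = ≤-trans
    (s≤s (sumFrom1-monoˡ A (n≤1+n (suc m)))) (initial (3 + m) (s≤s z≤n) initialRange)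
  ... | no beyond = begin-strict
    sumFrom1 m A + A (suc m)      <⟨ +-monoˡ-< (A (suc m)) (prefixSum<+2 m) ⟩
    A (2 + m) + A (suc m)         ≡⟨ +-comm (A (2 + m)) (A (suc m)) ⟩
    A (suc m) + A (2 + m)         ≤⟨ twoStep (suc m) (≤-pred (≤-pred (≰⇒> beyond))) ⟩
    A (3 + m)                     ∎
    where open ≤-Reasoning

  prefixSum< : ∀ j → sumFrom1 (j ∸ 1) A < A (suc j)
  prefixSum< zero    = positive 1 (s≤s z≤n)
  prefixSum< (suc m) = prefixSum<+2 m

  -- A 0/1 sequence whose value is below A (k+1) uses no index beyond k,
  -- since any used index i > k would contribute A i ≥ A (k+1).
  nothingAbove : ∀ (s : FinSeq) k → value A s < A (suc k) → VanishesAbove (FinSeq.a s) k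
  nothingAbove s k small i k<i with FinSeq.a s i in used
  ... | false = refl
  ... | true  = ⊥-elim (<⇒≱ small (≤-trans (monotone (s≤s z≤n) k<i)
                  (used≤value A s (≤-trans (s≤s z≤n) k<i) used)))

open QuasifibonacciFacts using (prefixSum<; nothingAbove)

lemma2p1 : (N : ℕ) → 2 ≤ N → (A : ℕ → ℕ) → Quasifibonacci N A →
    (k : ℕ) → 1 ≤ k → (n : ℕ) → A k ≤ n → n < A (suc k) →
    (s : FinSeq) → InS A n s →
    HasLength s (k ∸ 1) ⊎ HasLength s k
lemma2p1 (suc zero) (s≤s ()) _ _ _ _ _ _ _ _ _
lemma2p1 (suc (suc N')) _ A Q (suc j) _ n Aₖ≤n n<Aₖ₊₁ s value≡n
  with lengthNearTop s j (nothingAbove Q s (suc j) (subst (_< A (2 + j)) (sym value≡n) n<Aₖ₊₁))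
... | inj₁ len           = inj₁ len
... | inj₂ (inj₁ len)    = inj₂ len
... | inj₂ (inj₂ vanish) = ⊥-elim (<⇒≱ (prefixSum< Q j) (begin
  A (suc j)           ≤⟨ Aₖ≤n ⟩
  n                   ≡⟨ sym value≡n ⟩
  value A s           ≤⟨ value≤sumFrom1 A s (j ∸ 1) vanish ⟩
  sumFrom1 (j ∸ 1) A  ∎))
  where open ≤-Reasoning
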